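{- Let $\kappa$ be a cardinal and let $\mathcal{I}$ be an injective $\Omega_\kappa$-system. Then there is a family $\{i_{fg}\colon\overline{I}_f\to\overline{I}_g\mid f\leq g\in\omega^\kappa\}$ of homomorphisms such that for all $f\leq g$: (1) $p_{g,f}\,i_{fg}=\mathrm{id}_{\overline{I}_f}$; (2) if $z\in I_f$ then $i_{fg}(z)\in I_g$.
   Context: An $\Omega_\kappa$-system $\mathcal{I}$ consists of abelian groups $I_{\alpha,k}$ ($\alpha<\kappa$, $k<\omega$) and compatible homomorphisms $p_{\alpha,j,k}\colon I_{\alpha,j}\to I_{\alpha,k}$ ($j\geq k$). For $x\in\omega^\kappa$, $I_x=\bigoplus_\alpha I_{\alpha,x(\alpha)}\subseteq\overline{I}_x=\prod_\alpha I_{\alpha,x(\alpha)}$, and for $x\leq y$ (pointwise), $p_{y,x}=\prod_\alpha p_{\alpha,y(\alpha),x(\alpha)}\colon\overline{I}_y\to\overline{I}_x$. A morphism $\varphi\colon\mathcal{G}\to\mathcal{H}$ of $\Omega_\kappa$-systems is a family of homomorphisms $\varphi_{\alpha,k}\colon G_{\alpha,k}\to H_{\alpha,k}$ commuting with the structure maps. $\mathcal{I}$ is injective if whenever $\varphi\colon\mathcal{G}\to\mathcal{I}$ and $\psi\colon\mathcal{G}\to\mathcal{H}$ are morphisms with every $\psi_{\alpha,k}$ injective, there is $\overline{\varphi}\colon\mathcal{H}\to\mathcal{I}$ with $\overline{\varphi}\psi=\varphi$. -}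

module Defs where

open import Level using (Level; _⊔_) renaming (suc to lsuc; zero to lzero)
open import Data.Nat using (ℕ; _≤_)
open import Data.Nat.Properties using (≤-refl; ≤-trans)
open import Data.List using (List)
open import Data.List.Membership.Propositional using (_∈_)
open import Data.Product using (Σ; ∃; _×_; _,_)
open import Relation.Nullary using (¬_)
open import Algebra.Bundles using (AbelianGroup; RawGroup)
open import Algebra.Morphism.Bundles using (GroupHomomorphism)
open import Function.Definitions using (Injective)

Hom : ∀ {c ℓ c' ℓ'} → AbelianGroup c ℓ → AbelianGroup c' ℓ' → Set (c ⊔ ℓ ⊔ c' ⊔ ℓ')
Hom A B = GroupHomomorphism (AbelianGroup.rawGroup A) (AbelianGroup.rawGroup B)

-- An Ω_κ-system, with κ represented by an arbitrary index type K.
-- Compatibility: p_{α,j,j} = id and p_{α,k,l} ∘ p_{α,j,k} = p_{α,j,l} (l ≤ k ≤ j).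
record ΩSystem (K : Set) (c ℓ : Level) : Set (lsuc (c ⊔ ℓ)) where
  field
    grp : K → ℕ → AbelianGroup c ℓ
    p   : ∀ α j k → k ≤ j → Hom (grp α j) (grp α k)
  Car : K → ℕ → Set c
  Car α k = AbelianGroup.Carrier (grp α k)
  pf : ∀ α j k → k ≤ j → Car α j → Car α k
  pf α j k h = GroupHomomorphism.⟦_⟧ (p α j k h)
  field
    p-id   : ∀ α j (x : Car α j) → AbelianGroup._≈_ (grp α j) (pf α j j ≤-refl x) x
    p-comp : ∀ α j k l (hjk : k ≤ j) (hkl : l ≤ k) (x : Car α j) →
             AbelianGroup._≈_ (grp α l)
               (pf α k l hkl (pf α j k hjk x)) (pf α j l (≤-trans hkl hjk) x)

module _ {K : Set} where
  open ΩSystem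

  record Morphism {c ℓ c' ℓ'} (G : ΩSystem K c ℓ) (H : ΩSystem K c' ℓ') : Set (c ⊔ ℓ ⊔ c' ⊔ ℓ') where
    field
      φ : ∀ α k → Hom (grp G α k) (grp H α k)
    φf : ∀ α k → Car G α k → Car H α k
    φf α k = GroupHomomorphism.⟦_⟧ (φ α k)
    field
      commute : ∀ α j k (h : k ≤ j) (x : Car G α j) →
                AbelianGroup._≈_ (grp H α k)
                  (φf α k (pf G α j k h x)) (pf H α j k h (φf α j x))

  open Morphism

  _∘≈_ : ∀ {c₁ ℓ₁ c₂ ℓ₂ c₃ ℓ₃} {G : ΩSystem K c₁ ℓ₁} {H : ΩSystem K c₂ ℓ₂} {I : ΩSystem K c₃ ℓ₃} →
         Morphism H I → Morphism G H → Morphism G I → Set (c₁ ⊔ ℓ₃)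
  _∘≈_ {G = G} {I = I} χ ψ φ' = ∀ α k (x : Car G α k) →
    AbelianGroup._≈_ (grp I α k) (φf χ α k (φf ψ α k x)) (φf φ' α k x)

  -- Injective Ω_κ-system (test systems G, H range over the same universe levels as I).
  IsInjective : ∀ {c ℓ} → ΩSystem K c ℓ → Set (lsuc (c ⊔ ℓ))
  IsInjective {c} {ℓ} I =
    (G H : ΩSystem K c ℓ) (φ' : Morphism G I) (ψ : Morphism G H) →
    (∀ α k → Injective (AbelianGroup._≈_ (grp G α k)) (AbelianGroup._≈_ (grp H α k)) (φf ψ α k)) →
    Σ (Morphism H I) λ φ̄ → (φ̄ ∘≈ ψ) φ'

  _≤ω_ : (K → ℕ) → (K → ℕ) → Set
  x ≤ω y = ∀ α → x α ≤ y α

  Ībar : ∀ {c ℓ} → ΩSystem K c ℓ → (K → ℕ) → RawGroup c ℓ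
  Ībar I x = record
    { Carrier = (α : K) → Car I α (x α)
    ; _≈_ = λ u v → ∀ α → AbelianGroup._≈_ (grp I α (x α)) (u α) (v α)
    ; _∙_ = λ u v α → AbelianGroup._∙_ (grp I α (x α)) (u α) (v α)
    ; ε = λ α → AbelianGroup.ε (grp I α (x α))
    ; _⁻¹ = λ u α → AbelianGroup._⁻¹ (grp I α (x α)) (u α)
    }

  -- Membership in the direct sum  I_x ⊆ Ī_x : finite support.
  InSum : ∀ {c ℓ} (I : ΩSystem K c ℓ) (x : K → ℕ) → ((α : K) → Car I α (x α)) → Set (ℓ)
  InSum I x z = ∃ λ (L : List K) → ∀ α → ¬ (α ∈ L) → AbelianGroup._≈_ (grp I α (x α)) (z α) (AbelianGroup.ε (grp I α (x α)))

  pbar : ∀ {c ℓ} (I : ΩSystem K c ℓ) (x y : K → ℕ) → x ≤ω y →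
         ((α : K) → Car I α (y α)) → ((α : K) → Car I α (x α))
  pbar I x y h z α = pf I α (y α) (x α) (h α) (z α)

module Submission where

open import Defs
open import Level using (Level)
open import Data.Nat using (ℕ; _≤_; _≤?_)
open import Data.Nat.Properties using (≤-irrelevant; ≤-refl; ≤-trans)
open import Data.Product using (Σ; _×_; _,_; proj₁; proj₂)
open import Data.Empty using (⊥-elim)
open import Data.Unit.Polymorphic using (tt)
open import Relation.Nullary using (Dec; yes; no)
open import Algebra.Bundles using (AbelianGroup)
open import Algebra.Morphism.Bundles using (GroupHomomorphism)
open import Function.Definitions using (Injective)
import Algebra.Construct.Terminal as Trivial
import Algebra.Morphism.Construct.Identity as Identity
import Algebra.Morphism.Construct.Composition as Composition

open GroupHomomorphism using (⟦_⟧; ⟦⟧-cong; ε-homo; isGroupHomomorphism)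
open Morphism using (φ; φf; commute)

-- For a fixed level k, let G (truncated k) be I with the groups above level k replaced by
-- trivial ones, and H (capped k) the system equal to I up to level k and constant at
-- I_{β,k} above it, with identity structure maps there.
-- G embeds into I and into H, so injectivity of I extends G → I to χ : H → I.  For
-- j ≥ k the map  I_{β,k} = H_{β,j} → I_{β,j}  given by χ is a right inverse of p_{β,j,k},
-- since χ commutes with the structure maps and is the identity at level k.  Taking these
-- sections coordinatewise gives i_{fg}, and it preserves finite support because each
-- coordinate is a homomorphism.

idHom : ∀ {c ℓ} (A : AbelianGroup c ℓ) → Hom A A
idHom A = Identity.groupHomomorphism (AbelianGroup.group A)

zeroHom : ∀ {a ℓa b ℓb} (A : AbelianGroup a ℓa) (B : AbelianGroup b ℓb) → Hom A B
zeroHom A B = record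
  { ⟦_⟧ = λ _ → ε
  ; isGroupHomomorphism = record
    { isMonoidHomomorphism = record
      { isMagmaHomomorphism = record
        { isRelHomomorphism = record { cong = λ _ → refl }
        ; homo = λ _ _ → sym (identityˡ ε) }
      ; ε-homo = refl }
    ; ⁻¹-homo = λ _ → trans (sym (inverseʳ ε)) (identityˡ (ε ⁻¹)) } }
  where open AbelianGroup B

module _ {K : Set} {c ℓ : Level} (I : ΩSystem K c ℓ) where
  open ΩSystem I
  private module I (β : K) (m : ℕ) = AbelianGroup (grp β m)

  pf-irrelevant : ∀ β j m (h h′ : m ≤ j) x → I._≈_ β m (pf β j m h x) (pf β j m h′ x)
  pf-irrelevant β j m h h′ x rewrite ≤-irrelevant h h′ = I.refl β m

  pf-refl : ∀ β j (h : j ≤ j) x → I._≈_ β j (pf β j j h x) x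
  pf-refl β j h x = I.trans β j (pf-irrelevant β j j h ≤-refl x) (p-id β j x)

  Π-hom : ∀ {f g} → (∀ α → Hom (grp α (f α)) (grp α (g α))) →
          GroupHomomorphism (Ībar I f) (Ībar I g)
  Π-hom s = record
    { ⟦_⟧ = λ z α → ⟦ s α ⟧ (z α)
    ; isGroupHomomorphism = record
      { isMonoidHomomorphism = record
        { isMagmaHomomorphism = record
          { isRelHomomorphism = record { cong = λ e α → ⟦⟧-cong (s α) (e α) }
          ; homo = λ x y α → GroupHomomorphism.homo (s α) (x α) (y α) }
        ; ε-homo = λ α → ε-homo (s α) }
      ; ⁻¹-homo = λ x α → GroupHomomorphism.⁻¹-homo (s α) (x α) } }

  Π-hom-InSum : ∀ {f g} (s : ∀ α → Hom (grp α (f α)) (grp α (g α))) z →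
                InSum I f z → InSum I g (⟦ Π-hom s ⟧ z)
  Π-hom-InSum {g = g} s z (L , outside-L≈ε) =
    L , λ α α∉L → I.trans α (g α) (⟦⟧-cong (s α) (outside-L≈ε α α∉L)) (ε-homo (s α))

  module AtLevel (k : ℕ) where

    Truncated : K → ∀ m → Dec (m ≤ k) → AbelianGroup c ℓ
    Truncated β m (yes _) = grp β m
    Truncated β m (no _)  = Trivial.abelianGroup

    Capped : K → ∀ m → Dec (m ≤ k) → AbelianGroup c ℓ
    Capped β m (yes _) = grp β m
    Capped β m (no _)  = grp β k

    truncated-p : ∀ β j m → m ≤ j → ∀ dj dm → Hom (Truncated β j dj) (Truncated β m dm)
    truncated-p β j m m≤j (yes _)   (yes _)   = p β j m m≤j
    truncated-p β j m m≤j (no _)    (yes _)   = zeroHom Trivial.abelianGroup (grp β m)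
    truncated-p β j m m≤j (no _)    (no _)    = idHom Trivial.abelianGroup
    truncated-p β j m m≤j (yes j≤k) (no m≰k) = ⊥-elim (m≰k (≤-trans m≤j j≤k))

    capped-p : ∀ β j m → m ≤ j → ∀ dj dm → Hom (Capped β j dj) (Capped β m dm)
    capped-p β j m m≤j (yes _)   (yes _)   = p β j m m≤j
    capped-p β j m m≤j (no _)    (yes m≤k) = p β k m m≤k
    capped-p β j m m≤j (no _)    (no _)    = idHom (grp β k)
    capped-p β j m m≤j (yes j≤k) (no m≰k) = ⊥-elim (m≰k (≤-trans m≤j j≤k))

    truncated-p-comp : ∀ β j m l (m≤j : m ≤ j) (l≤m : l ≤ m) dj dm dl x →
      AbelianGroup._≈_ (Truncated β l dl)
        (⟦ truncated-p β m l l≤m dm dl ⟧ (⟦ truncated-p β j m m≤j dj dm ⟧ x))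
        (⟦ truncated-p β j l (≤-trans l≤m m≤j) dj dl ⟧ x)
    truncated-p-comp β j m l m≤j l≤m (yes _) (yes _) (yes _) x = p-comp β j m l m≤j l≤m x
    truncated-p-comp β j m l m≤j l≤m (no _)  (yes _) (yes _) x = ε-homo (p β m l l≤m)
    truncated-p-comp β j m l m≤j l≤m (no _)  (no _)  (yes _) x = I.refl β l
    truncated-p-comp β j m l m≤j l≤m (no _)  (no _)  (no _)  x = tt
    truncated-p-comp β j m l m≤j l≤m (yes j≤k) (no m≰k) _ x = ⊥-elim (m≰k (≤-trans m≤j j≤k))
    truncated-p-comp β j m l m≤j l≤m _ (yes m≤k) (no l≰k) x = ⊥-elim (l≰k (≤-trans l≤m m≤k))

    capped-p-comp : ∀ β j m l (m≤j : m ≤ j) (l≤m : l ≤ m) dj dm dl x →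
      AbelianGroup._≈_ (Capped β l dl)
        (⟦ capped-p β m l l≤m dm dl ⟧ (⟦ capped-p β j m m≤j dj dm ⟧ x))
        (⟦ capped-p β j l (≤-trans l≤m m≤j) dj dl ⟧ x)
    capped-p-comp β j m l m≤j l≤m (yes _) (yes _)   (yes _) x = p-comp β j m l m≤j l≤m x
    capped-p-comp β j m l m≤j l≤m (no _)  (yes m≤k) (yes _) x =
      I.trans β l (p-comp β k m l m≤k l≤m x) (pf-irrelevant β k l _ _ x)
    capped-p-comp β j m l m≤j l≤m (no _)  (no _)    (yes _) x = pf-irrelevant β k l _ _ x
    capped-p-comp β j m l m≤j l≤m (no _)  (no _)    (no _)  x = I.refl β k
    capped-p-comp β j m l m≤j l≤m (yes j≤k) (no m≰k) _ x = ⊥-elim (m≰k (≤-trans m≤j j≤k))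
    capped-p-comp β j m l m≤j l≤m _ (yes m≤k) (no l≰k) x = ⊥-elim (l≰k (≤-trans l≤m m≤k))

    truncated : ΩSystem K c ℓ
    truncated = record
      { grp    = λ β m → Truncated β m (m ≤? k)
      ; p      = λ β j m m≤j → truncated-p β j m m≤j (j ≤? k) (m ≤? k)
      ; p-id   = λ β j → id-law β j (j ≤? k)
      ; p-comp = λ β j m l m≤j l≤m →
          truncated-p-comp β j m l m≤j l≤m (j ≤? k) (m ≤? k) (l ≤? k) }
      where
      id-law : ∀ β j d x → AbelianGroup._≈_ (Truncated β j d) (⟦ truncated-p β j j ≤-refl d d ⟧ x) x
      id-law β j (yes _) x = p-id β j x
      id-law β j (no _)  x = tt

    capped : ΩSystem K c ℓ
    capped = record
      { grp    = λ β m → Capped β m (m ≤? k)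
      ; p      = λ β j m m≤j → capped-p β j m m≤j (j ≤? k) (m ≤? k)
      ; p-id   = λ β j → id-law β j (j ≤? k)
      ; p-comp = λ β j m l m≤j l≤m →
          capped-p-comp β j m l m≤j l≤m (j ≤? k) (m ≤? k) (l ≤? k) }
      where
      id-law : ∀ β j d x → AbelianGroup._≈_ (Capped β j d) (⟦ capped-p β j j ≤-refl d d ⟧ x) x
      id-law β j (yes _) x = p-id β j x
      id-law β j (no _)  x = I.refl β k

    truncated↪I : ∀ β m d → Hom (Truncated β m d) (grp β m)
    truncated↪I β m (yes _) = idHom (grp β m)
    truncated↪I β m (no _)  = zeroHom Trivial.abelianGroup (grp β m)

    truncated⇒I : Morphism truncated I
    truncated⇒I = record
      { φ       = λ β m → truncated↪I β m (m ≤? k)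
      ; commute = λ β j m m≤j → commutes β j m m≤j (j ≤? k) (m ≤? k) }
      where
      commutes : ∀ β j m (m≤j : m ≤ j) dj dm x →
        I._≈_ β m (⟦ truncated↪I β m dm ⟧ (⟦ truncated-p β j m m≤j dj dm ⟧ x))
                  (pf β j m m≤j (⟦ truncated↪I β j dj ⟧ x))
      commutes β j m m≤j (yes _)   (yes _)   x = I.refl β m
      commutes β j m m≤j (no _)    (yes _)   x = I.sym β m (ε-homo (p β j m m≤j))
      commutes β j m m≤j (no _)    (no _)    x = I.sym β m (ε-homo (p β j m m≤j))
      commutes β j m m≤j (yes j≤k) (no m≰k) x = ⊥-elim (m≰k (≤-trans m≤j j≤k))

    truncated↪capped : ∀ β m d → Hom (Truncated β m d) (Capped β m d)
    truncated↪capped β m (yes _) = idHom (grp β m)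
    truncated↪capped β m (no _)  = zeroHom Trivial.abelianGroup (grp β k)

    truncated↪capped-injective : ∀ β m d →
      Injective (AbelianGroup._≈_ (Truncated β m d)) (AbelianGroup._≈_ (Capped β m d))
                ⟦ truncated↪capped β m d ⟧
    truncated↪capped-injective β m (yes _) e = e
    truncated↪capped-injective β m (no _)  e = tt

    truncated⇒capped : Morphism truncated capped
    truncated⇒capped = record
      { φ       = λ β m → truncated↪capped β m (m ≤? k)
      ; commute = λ β j m m≤j → commutes β j m m≤j (j ≤? k) (m ≤? k) }
      where
      commutes : ∀ β j m (m≤j : m ≤ j) dj dm x →
        AbelianGroup._≈_ (Capped β m dm)
          (⟦ truncated↪capped β m dm ⟧ (⟦ truncated-p β j m m≤j dj dm ⟧ x))
          (⟦ capped-p β j m m≤j dj dm ⟧ (⟦ truncated↪capped β j dj ⟧ x))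
      commutes β j m m≤j (yes _)   (yes _)   x = I.refl β m
      commutes β j m m≤j (no _)    (yes m≤k) x = I.sym β m (ε-homo (p β k m m≤k))
      commutes β j m m≤j (no _)    (no _)    x = I.refl β k
      commutes β j m m≤j (yes j≤k) (no m≰k) x = ⊥-elim (m≰k (≤-trans m≤j j≤k))

    fromTop : ∀ β j d → Hom (grp β k) (Capped β j d)
    fromTop β j (yes j≤k) = p β k j j≤k
    fromTop β j (no _)    = idHom (grp β k)

    capped-p∘fromTop : ∀ β j (k≤j : k ≤ j) (k≤k : k ≤ k) dj x →
      I._≈_ β k (⟦ capped-p β j k k≤j dj (yes k≤k) ⟧ (⟦ fromTop β j dj ⟧ x)) x
    capped-p∘fromTop β j k≤j k≤k (yes j≤k) x =
      I.trans β k (p-comp β k j k j≤k k≤j x) (pf-refl β k _ x)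
    capped-p∘fromTop β j k≤j k≤k (no _) x = pf-refl β k k≤k x

    -- Stated for an arbitrary proof of k ≤? k, which does not reduce for a variable k.
    extension-at-top : ∀ β (dk : Dec (k ≤ k)) (χₖ : Hom (Capped β k dk) (grp β k)) →
      (∀ x → I._≈_ β k (⟦ χₖ ⟧ (⟦ truncated↪capped β k dk ⟧ x)) (⟦ truncated↪I β k dk ⟧ x)) →
      ∀ j (k≤j : k ≤ j) dj x →
      I._≈_ β k (⟦ χₖ ⟧ (⟦ capped-p β j k k≤j dj dk ⟧ (⟦ fromTop β j dj ⟧ x))) x
    extension-at-top β (no k≰k)  χₖ extends j k≤j dj x = ⊥-elim (k≰k ≤-refl)
    extension-at-top β (yes k≤k) χₖ extends j k≤j dj x =
      I.trans β k (⟦⟧-cong χₖ (capped-p∘fromTop β j k≤j k≤k dj x)) (extends x)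

  module _ (injective : IsInjective I) where
    open AtLevel

    extension : ∀ k → Σ (Morphism (capped k) I) λ χ → (χ ∘≈ truncated⇒capped k) (truncated⇒I k)
    extension k = injective (truncated k) (capped k) (truncated⇒I k) (truncated⇒capped k)
                    (λ β m → truncated↪capped-injective k β m (m ≤? k))

    section : ∀ β k j → Hom (grp β k) (grp β j)
    section β k j = record
      { ⟦_⟧ = λ x → φf χ β j (⟦ fromTop k β j (j ≤? k) ⟧ x)
      ; isGroupHomomorphism = Composition.isGroupHomomorphism (I.trans β j)
          (isGroupHomomorphism (fromTop k β j (j ≤? k))) (isGroupHomomorphism (φ χ β j)) }
      where
      χ : Morphism (capped k) I
      χ = proj₁ (extension k)

    p∘section : ∀ β {k j} (k≤j : k ≤ j) x → I._≈_ β k (pf β j k k≤j (⟦ section β k j ⟧ x)) x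
    p∘section β {k} {j} k≤j x =
      I.trans β k (I.sym β k (commute χ β j k k≤j (⟦ fromTop k β j (j ≤? k) ⟧ x)))
        (extension-at-top k β (k ≤? k) (φ χ β k) (χ-extends β k) j k≤j (j ≤? k) x)
      where
      χ : Morphism (capped k) I
      χ = proj₁ (extension k)
      χ-extends : (χ ∘≈ truncated⇒capped k) (truncated⇒I k)
      χ-extends = proj₂ (extension k)

corollary3p14 : {K : Set} {c ℓ : Level} (I : ΩSystem K c ℓ) → IsInjective I →
    Σ ((f g : K → ℕ) → f ≤ω g → GroupHomomorphism (Ībar I f) (Ībar I g)) λ i →
      (f g : K → ℕ) (h : f ≤ω g) →
        ((z : (α : K) → ΩSystem.Car I α (f α)) → (α : K) →
          AbelianGroup._≈_ (ΩSystem.grp I α (f α))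
            (pbar I f g h (GroupHomomorphism.⟦_⟧ (i f g h) z) α) (z α))
        × ((z : (α : K) → ΩSystem.Car I α (f α)) → InSum I f z →
            InSum I g (GroupHomomorphism.⟦_⟧ (i f g h) z))
corollary3p14 I injective =
  (λ f g h → Π-hom I (sections f g)) ,
  λ f g h → (λ z α → p∘section I injective α (h α) (z α)) , Π-hom-InSum I (sections f g)
  where
  sections : ∀ f g α → Hom (ΩSystem.grp I α (f α)) (ΩSystem.grp I α (g α))
  sections f g α = section I injective α (f α) (g α)
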